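{- Let $k\ge 1$. The number of unordered positions $\{a,b,a+b\}$, where $\{a,b\}$ is an unordered pair of positive integers with $a\oplus b\oplus(a+b)=0$, in which two of the three piles have exactly $k$ binary digits, equals $3^{k-1}-2^{k-1}$.
   Context: $\oplus$ denotes bitwise exclusive-or. The number of binary digits of a positive integer $n$ is $\lfloor \log_2 n\rfloor+1$. -}

module Defs where

open import Data.Nat using (ℕ; zero; suc; _+_; _*_; _<_; _≟_)
open import Data.Nat.DivMod using (_/_; _%_)
open import Data.Nat.Logarithm using (⌊log₂_⌋)
open import Data.List using (List; length; filter; _∷_; [])
open import Data.Product using (Σ; _×_)
open import Relation.Binary.PropositionalEquality using (_≡_)

bitXor : ℕ → ℕ → ℕ
bitXor zero zero = 0
bitXor zero (suc _) = 1
bitXor (suc _) zero = 1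
bitXor (suc _) (suc _) = 0

-- bitwise xor with fuel; fuel m + n is always sufficient
xorAux : ℕ → ℕ → ℕ → ℕ
xorAux zero _ _ = 0
xorAux (suc f) m n = bitXor (m % 2) (n % 2) + 2 * xorAux f (m / 2) (n / 2)

_⊕_ : ℕ → ℕ → ℕ
m ⊕ n = xorAux (m + n) m n
infixl 6 _⊕_

-- number of binary digits ⌊log₂ n⌋ + 1 (used for positive n)
digits : ℕ → ℕ
digits n = ⌊log₂ n ⌋ + 1

pilesWithDigits : ℕ → List ℕ → ℕ
pilesWithDigits k ps = length (filter (λ p → digits p ≟ k) ps)

-- positions {a, b, a+b} with {a,b} an unordered pair (represented as a < b)
-- of positive integers, a ⊕ b ⊕ (a+b) = 0, two of the three piles having k digits
Position : ℕ → Set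
Position k = Σ ℕ λ a → Σ ℕ λ b →
  (0 < a) × (a < b) × (a ⊕ b ⊕ (a + b) ≡ 0) ×
  (pilesWithDigits k (a ∷ b ∷ (a + b) ∷ []) ≡ 2)

module Submission where

-- Adding a and b produces no carry exactly when a ⊕ b = a + b, i.e. when no bit is set in both;
-- and a ⊕ b ⊕ (a + b) = 0 says precisely that a ⊕ b = a + b. In a position a < b < a + b the
-- piles have nondecreasing numbers of digits, so two of them have k digits only if b does. The
-- top bit 2^(k-1) of b is then missing from a, hence a < 2^(k-1), b = c + 2^(k-1) with c < 2^(k-1),
-- and a + b has k digits as well. So positions correspond to bit-disjoint pairs (a, c) below
-- 2^(k-1) with a > 0, that is, to words of length k-1 over {N, A, B} (bit i lies in neither, in a,
-- or in c) containing an A. Splitting such a word at its first A gives w(n+1) = 3^n + 2 w(n),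
-- whence w(n) = 3^n - 2^n.

open import Defs
open import Data.Nat using (ℕ; _≤_; _^_; _∸_)
open import Data.Fin using (Fin)
open import Function.Bundles using (_↔_)

open import Data.Nat using (zero; suc; _+_; _*_; _<_; _≟_; z≤n; s≤s; NonZero; ⌊_/2⌋)
open import Data.Nat.Properties
open import Data.Nat.DivMod
open import Data.Nat.Divisibility using (m∣m*n)
open import Data.Nat.Logarithm
open import Data.Nat.Solver using (module +-*-Solver)
open import Data.Fin.Properties using (+↔⊎; *↔×)
open import Data.Fin.Patterns using (0F; 1F; 2F)
import Data.Fin as Fin
open import Data.Vec using (Vec; []; _∷_)
open import Data.List using ([]; _∷_; length)
open import Data.List.Properties using (filter-accept; filter-reject; length-filter)
open import Data.Product using (_×_; _,_; proj₁; proj₂)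
open import Data.Product.Function.NonDependent.Propositional using (_×-↔_)
open import Data.Sum using (_⊎_; inj₁; inj₂; map)
open import Data.Sum.Function.Propositional using (_⊎-↔_)
open import Data.Unit using (⊤; tt)
open import Function using (_∘_)
open import Function.Bundles using (mk↔ₛ′)
open import Function.Properties.Inverse using (↔-refl; ↔-trans)
open import Function.Related.Propositional using (module EquationalReasoning)
open import Relation.Binary.PropositionalEquality
open import Relation.Nullary using (yes; no; contradiction)
open +-*-Solver using (solve; _:=_; _:+_; _:*_; con)

[r+d*q]%d≡r : ∀ {r d} q .{{_ : NonZero d}} → r < d → (r + d * q) % d ≡ r
[r+d*q]%d≡r {r} {d} q r<d = begin
  (r + d * q) % d ≡⟨ cong (λ t → (r + t) % d) (*-comm d q) ⟩
  (r + q * d) % d ≡⟨ [m+kn]%n≡m%n r q d ⟩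
  r % d           ≡⟨ m<n⇒m%n≡m r<d ⟩
  r               ∎
  where open ≡-Reasoning

[r+d*q]/d≡q : ∀ {r d} q .{{_ : NonZero d}} → r < d → (r + d * q) / d ≡ q
[r+d*q]/d≡q {r} {d} q r<d = begin
  (r + d * q) / d   ≡⟨ +-distrib-/-∣ʳ r (m∣m*n q) ⟩
  r / d + d * q / d ≡⟨ cong₂ _+_ (m<n⇒m/n≡0 r<d) (cong (_/ d) (*-comm d q)) ⟩
  q * d / d         ≡⟨ m*n/n≡m q d ⟩
  q                 ∎
  where open ≡-Reasoning

[b+2*q]%2≡b : ∀ {b} q → b ≤ 1 → (b + 2 * q) % 2 ≡ b
[b+2*q]%2≡b q b≤1 = [r+d*q]%d≡r q (s≤s b≤1)

[b+2*q]/2≡q : ∀ {b} q → b ≤ 1 → (b + 2 * q) / 2 ≡ q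
[b+2*q]/2≡q q b≤1 = [r+d*q]/d≡q q (s≤s b≤1)

m≡m%2+2*[m/2] : ∀ m → m ≡ m % 2 + 2 * (m / 2)
m≡m%2+2*[m/2] m = trans (m≡m%n+[m/n]*n m 2) (cong (m % 2 +_) (*-comm (m / 2) 2))

m%2≤1 : ∀ m → m % 2 ≤ 1
m%2≤1 m = ≤-pred (m%n<n m 2)

m≤1⇒m%2≡0⇒m≡0 : ∀ {m} → m ≤ 1 → m % 2 ≡ 0 → m ≡ 0
m≤1⇒m%2≡0⇒m≡0 {zero}        _        _ = refl
m≤1⇒m%2≡0⇒m≡0 {suc zero}    _        ()
m≤1⇒m%2≡0⇒m≡0 {suc (suc _)} (s≤s ()) _

[a+2c]+[b+2d]≡[a+b]+2[c+d] : ∀ a b c d → (a + 2 * c) + (b + 2 * d) ≡ (a + b) + 2 * (c + d)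
[a+2c]+[b+2d]≡[a+b]+2[c+d] = solve 4
  (λ a b c d → (a :+ con 2 :* c) :+ (b :+ con 2 :* d) := (a :+ b) :+ con 2 :* (c :+ d)) refl

m+n≡[m%2+n%2]+2*[m/2+n/2] : ∀ m n → m + n ≡ (m % 2 + n % 2) + 2 * (m / 2 + n / 2)
m+n≡[m%2+n%2]+2*[m/2+n/2] m n =
  trans (cong₂ _+_ (m≡m%2+2*[m/2] m) (m≡m%2+2*[m/2] n))
        ([a+2c]+[b+2d]≡[a+b]+2[c+d] (m % 2) (n % 2) (m / 2) (n / 2))

2*m≤1+n⇒m≤n : ∀ m {n} → 2 * m ≤ suc n → m ≤ n
2*m≤1+n⇒m≤n zero    _       = z≤n
2*m≤1+n⇒m≤n (suc m) (s≤s p) = ≤-trans (s≤s (m≤m+n m 0)) (≤-trans (m≤n+m _ m) p)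

m≤1+n⇒m/2≤n : ∀ m {n} → m ≤ suc n → m / 2 ≤ n
m≤1+n⇒m/2≤n m m≤1+n =
  2*m≤1+n⇒m≤n (m / 2) (≤-trans (≤-reflexive (*-comm 2 (m / 2))) (≤-trans (m/n*n≤m m 2) m≤1+n))

b+2*m<2*n : ∀ {b m n} → b ≤ 1 → m < n → b + 2 * m < 2 * n
b+2*m<2*n {b} {m} {n} b≤1 m<n = begin-strict
  b + 2 * m <⟨ s≤s (+-monoˡ-≤ (2 * m) b≤1) ⟩
  2 + 2 * m ≡⟨ *-suc 2 m ⟨
  2 * suc m ≤⟨ *-monoʳ-≤ 2 m<n ⟩
  2 * n     ∎
  where open ≤-Reasoning

+-mono-≤-≡⇒≡ : ∀ {a b c d} → a ≤ c → b ≤ d → a + b ≡ c + d → a ≡ c × b ≡ d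
+-mono-≤-≡⇒≡ {a} {b} {c} {d} a≤c b≤d e =
  ≤-antisym a≤c (+-cancelʳ-≤ d c a (≤-trans (≤-reflexive (sym e)) (+-monoʳ-≤ a b≤d))) ,
  ≤-antisym b≤d (+-cancelˡ-≤ c d b (≤-trans (≤-reflexive (sym e)) (+-monoˡ-≤ b a≤c)))

m+n*0≡m : ∀ m n → m + n * 0 ≡ m
m+n*0≡m m n = trans (cong (m +_) (*-zeroʳ n)) (+-identityʳ m)

r+p*q<2*p⇒q≤1 : ∀ r p {q} → r + p * q < 2 * p → q ≤ 1
r+p*q<2*p⇒q≤1 r p {q} r+pq<2p = ≤-pred (*-cancelˡ-< p q 2 (begin-strict
  p * q     ≤⟨ m≤n+m (p * q) r ⟩
  r + p * q <⟨ r+pq<2p ⟩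
  2 * p     ≡⟨ *-comm 2 p ⟩
  p * 2     ∎))
  where open ≤-Reasoning

r<p≤r+p*q<2*p⇒q≡1 : ∀ {r p q} → r < p → p ≤ r + p * q → r + p * q < 2 * p → q ≡ 1
r<p≤r+p*q<2*p⇒q≡1 {r} {p} {zero}  r<p p≤r+p*0 _ =
  contradiction (≤-trans p≤r+p*0 (≤-reflexive (m+n*0≡m r p))) (<⇒≱ r<p)
r<p≤r+p*q<2*p⇒q≡1 {r} {p} {suc q} _ _ r+pq<2p =
  ≤-antisym (r+p*q<2*p⇒q≤1 r p r+pq<2p) (s≤s z≤n)

-- Exclusive-or and carry-free addition

bitXor-≤ : ∀ m n → bitXor m n ≤ m + n
bitXor-≤ zero    zero    = z≤n
bitXor-≤ zero    (suc n) = s≤s z≤n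
bitXor-≤ (suc m) zero    = s≤s z≤n
bitXor-≤ (suc m) (suc n) = z≤n

bitXor-self : ∀ m → bitXor m m ≡ 0
bitXor-self zero    = refl
bitXor-self (suc m) = refl

bitXor≡0⇒≡ : ∀ {m n} → m ≤ 1 → n ≤ 1 → bitXor m n ≡ 0 → m ≡ n
bitXor≡0⇒≡ {zero}  {zero}  _         _         _ = refl
bitXor≡0⇒≡ {suc _} {suc _} (s≤s z≤n) (s≤s z≤n) _ = refl

bitXor≡+⇒m≡0∨n≡0 : ∀ {m n} → m ≤ 1 → n ≤ 1 → bitXor m n ≡ m + n → m ≡ 0 ⊎ n ≡ 0
bitXor≡+⇒m≡0∨n≡0 {zero}          _         _         _  = inj₁ refl
bitXor≡+⇒m≡0∨n≡0 {suc _} {zero}  _         _         _  = inj₂ refl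
bitXor≡+⇒m≡0∨n≡0 {suc _} {suc _} (s≤s z≤n) (s≤s z≤n) ()

m≡0∨n≡0⇒bitXor≡+ : ∀ {m n} → m ≤ 1 → n ≤ 1 → m ≡ 0 ⊎ n ≡ 0 → bitXor m n ≡ m + n
m≡0∨n≡0⇒bitXor≡+ {zero}  {zero}  _         _         _         = refl
m≡0∨n≡0⇒bitXor≡+ {zero}  {suc _} _         (s≤s z≤n) _         = refl
m≡0∨n≡0⇒bitXor≡+ {suc _} {zero}  (s≤s z≤n) _         _         = refl
m≡0∨n≡0⇒bitXor≡+ {suc _} {suc _} _         _         (inj₁ ())
m≡0∨n≡0⇒bitXor≡+ {suc _} {suc _} _         _         (inj₂ ())

xorAux-≤ : ∀ f x y → xorAux f x y ≤ x + y
xorAux-≤ zero    x y = z≤n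
xorAux-≤ (suc f) x y = begin
  bitXor (x % 2) (y % 2) + 2 * xorAux f (x / 2) (y / 2)
    ≤⟨ +-mono-≤ (bitXor-≤ (x % 2) (y % 2)) (*-monoʳ-≤ 2 (xorAux-≤ f (x / 2) (y / 2))) ⟩
  (x % 2 + y % 2) + 2 * (x / 2 + y / 2)
    ≡⟨ m+n≡[m%2+n%2]+2*[m/2+n/2] x y ⟨
  x + y ∎
  where open ≤-Reasoning

xorAux-self : ∀ f x → xorAux f x x ≡ 0
xorAux-self zero    x = refl
xorAux-self (suc f) x rewrite bitXor-self (x % 2) | xorAux-self f (x / 2) = refl

xorAux≡0⇒≡ : ∀ f {x y} → x ≤ f → y ≤ f → xorAux f x y ≡ 0 → x ≡ y
xorAux≡0⇒≡ zero    x≤0 y≤0 _ = trans (n≤0⇒n≡0 x≤0) (sym (n≤0⇒n≡0 y≤0))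
xorAux≡0⇒≡ (suc f) {x} {y} x≤1+f y≤1+f e = begin
  x                   ≡⟨ m≡m%2+2*[m/2] x ⟩
  x % 2 + 2 * (x / 2) ≡⟨ cong₂ (λ r q → r + 2 * q) low high ⟩
  y % 2 + 2 * (y / 2) ≡⟨ m≡m%2+2*[m/2] y ⟨
  y                   ∎
  where
  open ≡-Reasoning
  xorLow = bitXor (x % 2) (y % 2)
  xorHigh = xorAux f (x / 2) (y / 2)
  low : x % 2 ≡ y % 2
  low = bitXor≡0⇒≡ (m%2≤1 x) (m%2≤1 y) (m+n≡0⇒m≡0 xorLow e)
  high : x / 2 ≡ y / 2
  high = xorAux≡0⇒≡ f (m≤1+n⇒m/2≤n x x≤1+f) (m≤1+n⇒m/2≤n y y≤1+f)
           (m*n≡0⇒m≡0 xorHigh 2 (trans (*-comm xorHigh 2) (m+n≡0⇒n≡0 xorLow e)))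

⊕-self : ∀ x → x ⊕ x ≡ 0
⊕-self x = xorAux-self (x + x) x

⊕≡0⇒≡ : ∀ {x y} → x ⊕ y ≡ 0 → x ≡ y
⊕≡0⇒≡ {x} {y} = xorAux≡0⇒≡ (x + y) (m≤m+n x y) (m≤n+m y x)

Disjoint : ℕ → ℕ → ℕ → Set
Disjoint zero    x y = ⊤
Disjoint (suc m) x y = (x % 2 ≡ 0 ⊎ y % 2 ≡ 0) × Disjoint m (x / 2) (y / 2)

Disjoint-zeroˡ : ∀ m y → Disjoint m 0 y
Disjoint-zeroˡ zero    y = tt
Disjoint-zeroˡ (suc m) y = inj₁ refl , Disjoint-zeroˡ m (y / 2)

xorAux≡+⇒Disjoint : ∀ m f x y → xorAux f x y ≡ x + y → Disjoint m x y
xorAux≡+⇒Disjoint zero    f       x y e = tt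
xorAux≡+⇒Disjoint (suc m) zero    x y e rewrite m+n≡0⇒m≡0 x (sym e) = Disjoint-zeroˡ (suc m) y
xorAux≡+⇒Disjoint (suc m) (suc f) x y e =
  bitXor≡+⇒m≡0∨n≡0 (m%2≤1 x) (m%2≤1 y) (proj₁ split) ,
  xorAux≡+⇒Disjoint m f (x / 2) (y / 2) (*-cancelˡ-≡ _ _ 2 (proj₂ split))
  where
  split = +-mono-≤-≡⇒≡ (bitXor-≤ (x % 2) (y % 2)) (*-monoʳ-≤ 2 (xorAux-≤ f (x / 2) (y / 2)))
            (trans e (m+n≡[m%2+n%2]+2*[m/2+n/2] x y))

Disjoint⇒xorAux≡+ : ∀ f x y → x + y ≤ f → Disjoint f x y → xorAux f x y ≡ x + y
Disjoint⇒xorAux≡+ zero    x y x+y≤0   _             = sym (n≤0⇒n≡0 x+y≤0)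
Disjoint⇒xorAux≡+ (suc f) x y x+y≤1+f (low , high) = begin
  bitXor (x % 2) (y % 2) + 2 * xorAux f (x / 2) (y / 2)
    ≡⟨ cong₂ (λ r q → r + 2 * q) (m≡0∨n≡0⇒bitXor≡+ (m%2≤1 x) (m%2≤1 y) low)
                                  (Disjoint⇒xorAux≡+ f (x / 2) (y / 2) halves≤f high) ⟩
  (x % 2 + y % 2) + 2 * (x / 2 + y / 2)
    ≡⟨ m+n≡[m%2+n%2]+2*[m/2+n/2] x y ⟨
  x + y ∎
  where
  open ≡-Reasoning
  halves≤f : x / 2 + y / 2 ≤ f
  halves≤f = 2*m≤1+n⇒m≤n _ (≤-trans (m≤n+m _ (x % 2 + y % 2))
               (≤-trans (≤-reflexive (sym (m+n≡[m%2+n%2]+2*[m/2+n/2] x y))) x+y≤1+f))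

⊕-⊕-+≡0⇒Disjoint : ∀ {a b} → a ⊕ b ⊕ (a + b) ≡ 0 → ∀ m → Disjoint m a b
⊕-⊕-+≡0⇒Disjoint {a} {b} e m = xorAux≡+⇒Disjoint m (a + b) a b (⊕≡0⇒≡ e)

Disjoint⇒⊕-⊕-+≡0 : ∀ {a b} → Disjoint (a + b) a b → a ⊕ b ⊕ (a + b) ≡ 0
Disjoint⇒⊕-⊕-+≡0 {a} {b} d rewrite Disjoint⇒xorAux≡+ (a + b) a b ≤-refl d = ⊕-self (a + b)

-- Binary digits

⌊m/2⌋<n : ∀ {m n} → m < 2 * n → ⌊ m /2⌋ < n
⌊m/2⌋<n {zero}        {suc n} _    = s≤s z≤n
⌊m/2⌋<n {suc zero}    {suc n} _    = s≤s z≤n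
⌊m/2⌋<n {suc (suc m)} {suc n} m<2n =
  s≤s (⌊m/2⌋<n (≤-pred (≤-trans (≤-pred m<2n) (≤-reflexive (+-suc n (n + 0))))))

m∸1≤n⇒m≤1+n : ∀ m {n} → m ∸ 1 ≤ n → m ≤ suc n
m∸1≤n⇒m≤1+n zero    _ = z≤n
m∸1≤n⇒m≤1+n (suc m) p = s≤s p

m<2^[1+n]⇒⌊log₂m⌋≤n : ∀ {m} n → m < 2 ^ suc n → ⌊log₂ m ⌋ ≤ n
m<2^[1+n]⇒⌊log₂m⌋≤n {zero}        zero    _ = z≤n
m<2^[1+n]⇒⌊log₂m⌋≤n {suc zero}    zero    _ = z≤n
m<2^[1+n]⇒⌊log₂m⌋≤n {suc (suc m)} zero    (s≤s (s≤s ()))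
m<2^[1+n]⇒⌊log₂m⌋≤n {m}           (suc n) m<2^[2+n] = m∸1≤n⇒m≤1+n ⌊log₂ m ⌋
  (subst (_≤ n) (⌊log₂⌊n/2⌋⌋≡⌊log₂n⌋∸1 m) (m<2^[1+n]⇒⌊log₂m⌋≤n n (⌊m/2⌋<n m<2^[2+n])))

2^n≤m⇒n≤⌊log₂m⌋ : ∀ {m} n → 2 ^ n ≤ m → n ≤ ⌊log₂ m ⌋
2^n≤m⇒n≤⌊log₂m⌋ n 2^n≤m = subst (_≤ _) (⌊log₂[2^n]⌋≡n n) (⌊log₂⌋-mono-≤ 2^n≤m)

digits≡1+n⇒⌊log₂m⌋≡n : ∀ {m} n → digits m ≡ suc n → ⌊log₂ m ⌋ ≡ n
digits≡1+n⇒⌊log₂m⌋≡n {m} n e = +-cancelʳ-≡ 1 ⌊log₂ m ⌋ n (trans e (+-comm 1 n))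

2^n≤m<2^[1+n]⇒digits≡1+n : ∀ {m} n → 2 ^ n ≤ m → m < 2 ^ suc n → digits m ≡ suc n
2^n≤m<2^[1+n]⇒digits≡1+n n lo hi = trans
  (cong (_+ 1) (≤-antisym (m<2^[1+n]⇒⌊log₂m⌋≤n n hi) (2^n≤m⇒n≤⌊log₂m⌋ n lo)))
  (+-comm n 1)

digits≡1+n⇒2^n≤m : ∀ {m} n → 0 < m → digits m ≡ suc n → 2 ^ n ≤ m
digits≡1+n⇒2^n≤m     zero    0<m _ = 0<m
digits≡1+n⇒2^n≤m {m} (suc n) _   e = ≮⇒≥ λ m<2^[1+n] → 1+n≰n
  (subst (_≤ n) (digits≡1+n⇒⌊log₂m⌋≡n {m} (suc n) e) (m<2^[1+n]⇒⌊log₂m⌋≤n n m<2^[1+n]))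

digits≡1+n⇒m<2^[1+n] : ∀ {m} n → digits m ≡ suc n → m < 2 ^ suc n
digits≡1+n⇒m<2^[1+n] {m} n e = ≰⇒> λ 2^[1+n]≤m → 1+n≰n
  (subst (suc n ≤_) (digits≡1+n⇒⌊log₂m⌋≡n {m} n e) (2^n≤m⇒n≤⌊log₂m⌋ (suc n) 2^[1+n]≤m))

digits-mono-≤ : ∀ {m n} → m ≤ n → digits m ≤ digits n
digits-mono-≤ m≤n = +-monoˡ-≤ 1 (⌊log₂⌋-mono-≤ m≤n)

m<2^n⇒digits[m+2^n]≡1+n : ∀ {m} n → m < 2 ^ n → digits (m + 2 ^ n * 1) ≡ suc n
m<2^n⇒digits[m+2^n]≡1+n {m} n m<2^n = 2^n≤m<2^[1+n]⇒digits≡1+n n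
  (≤-trans (≤-reflexive (sym (*-identityʳ (2 ^ n)))) (m≤n+m _ m))
  (begin-strict
    m + 2 ^ n * 1     <⟨ +-monoˡ-< (2 ^ n * 1) m<2^n ⟩
    2 ^ n + 2 ^ n * 1 ≡⟨ cong (2 ^ n +_) (*-identityʳ (2 ^ n)) ⟩
    2 ^ n + 2 ^ n     ≡⟨ cong (2 ^ n +_) (+-identityʳ (2 ^ n)) ⟨
    2 ^ suc n         ∎)
  where open ≤-Reasoning

pilesWithDigits-accept : ∀ {k} p ps → digits p ≡ k →
                         pilesWithDigits k (p ∷ ps) ≡ suc (pilesWithDigits k ps)
pilesWithDigits-accept {k} p ps p≡k =
  cong length (filter-accept (λ p → digits p ≟ k) {p} {ps} p≡k)

pilesWithDigits-reject : ∀ {k} p ps → digits p ≢ k →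
                         pilesWithDigits k (p ∷ ps) ≡ pilesWithDigits k ps
pilesWithDigits-reject {k} p ps p≢k =
  cong length (filter-reject (λ p → digits p ≟ k) {p} {ps} p≢k)

pilesWithDigits≡2⇒middle : ∀ {k} a b c → digits a ≤ digits b → digits b ≤ digits c →
                           pilesWithDigits k (a ∷ b ∷ c ∷ []) ≡ 2 → digits b ≡ k
pilesWithDigits≡2⇒middle {k} a b c a≤b b≤c two with digits b ≟ k | digits a ≟ k
... | yes b≡k | _       = b≡k
... | no b≢k  | no a≢k  = contradiction (begin
  2                                    ≡⟨ two ⟨
  pilesWithDigits k (a ∷ b ∷ c ∷ [])   ≡⟨ pilesWithDigits-reject a (b ∷ c ∷ []) a≢k ⟩
  pilesWithDigits k (b ∷ c ∷ [])       ≡⟨ pilesWithDigits-reject b (c ∷ []) b≢k ⟩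
  pilesWithDigits k (c ∷ [])           ≤⟨ length-filter (λ p → digits p ≟ k) (c ∷ []) ⟩
  1                                    ∎) (λ { (s≤s ()) })
  where open ≤-Reasoning
... | no b≢k  | yes a≡k = contradiction (begin
  2                                    ≡⟨ two ⟨
  pilesWithDigits k (a ∷ b ∷ c ∷ [])   ≡⟨ pilesWithDigits-accept a (b ∷ c ∷ []) a≡k ⟩
  suc (pilesWithDigits k (b ∷ c ∷ [])) ≡⟨ cong suc (pilesWithDigits-reject b (c ∷ []) b≢k) ⟩
  suc (pilesWithDigits k (c ∷ []))     ≡⟨ cong suc (pilesWithDigits-reject c [] c≢k) ⟩
  1                                    ∎) (λ ())
  where
  open ≡-Reasoning
  k<b : k < digits b
  k<b = ≤∧≢⇒< (subst (_≤ digits b) a≡k a≤b) (b≢k ∘ sym)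
  c≢k : digits c ≢ k
  c≢k c≡k = <-irrefl (sym c≡k) (<-≤-trans k<b b≤c)

pilesWithDigits≡2 : ∀ {k} a b c → digits a ≢ k → digits b ≡ k → digits c ≡ k →
                    pilesWithDigits k (a ∷ b ∷ c ∷ []) ≡ 2
pilesWithDigits≡2 a b c a≢k b≡k c≡k = trans (pilesWithDigits-reject a (b ∷ c ∷ []) a≢k)
  (trans (pilesWithDigits-accept b (c ∷ []) b≡k) (cong suc (pilesWithDigits-accept c [] c≡k)))

-- Trit words and bit-disjoint pairs

-- Bit i of a disjoint pair (x, y) is set in x (A), in y (B), or in neither (N).
data Trit : Set where
  N A B : Trit

bitA : Trit → ℕ
bitA A = 1
bitA _ = 0

bitB : Trit → ℕ
bitB B = 1
bitB _ = 0

bitA≤1 : ∀ t → bitA t ≤ 1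
bitA≤1 N = z≤n
bitA≤1 A = s≤s z≤n
bitA≤1 B = z≤n

bitB≤1 : ∀ t → bitB t ≤ 1
bitB≤1 N = z≤n
bitB≤1 A = z≤n
bitB≤1 B = s≤s z≤n

bitA+bitB≤1 : ∀ t → bitA t + bitB t ≤ 1
bitA+bitB≤1 N = z≤n
bitA+bitB≤1 A = s≤s z≤n
bitA+bitB≤1 B = s≤s z≤n

bitA≡0⊎bitB≡0 : ∀ t → bitA t ≡ 0 ⊎ bitB t ≡ 0
bitA≡0⊎bitB≡0 N = inj₁ refl
bitA≡0⊎bitB≡0 A = inj₂ refl
bitA≡0⊎bitB≡0 B = inj₁ refl

encode : ∀ {A : Set} {n} → (A → ℕ) → Vec A n → ℕ
encode bit []       = 0
encode bit (t ∷ ts) = bit t + 2 * encode bit ts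

encode-< : ∀ {A : Set} {n} (bit : A → ℕ) → (∀ t → bit t ≤ 1) → (ts : Vec A n) →
           encode bit ts < 2 ^ n
encode-< bit bit≤1 []       = s≤s z≤n
encode-< bit bit≤1 (t ∷ ts) = b+2*m<2*n (bit≤1 t) (encode-< bit bit≤1 ts)

encode-+ : ∀ {A : Set} {n} (f g : A → ℕ) (ts : Vec A n) →
           encode (λ t → f t + g t) ts ≡ encode f ts + encode g ts
encode-+ f g []       = refl
encode-+ f g (t ∷ ts) = begin
  (f t + g t) + 2 * encode (λ t → f t + g t) ts
    ≡⟨ cong (λ e → (f t + g t) + 2 * e) (encode-+ f g ts) ⟩
  (f t + g t) + 2 * (encode f ts + encode g ts)
    ≡⟨ [a+2c]+[b+2d]≡[a+b]+2[c+d] (f t) (g t) (encode f ts) (encode g ts) ⟨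
  (f t + 2 * encode f ts) + (g t + 2 * encode g ts) ∎
  where open ≡-Reasoning

encode-∷-+ : ∀ {A : Set} {n} (bit : A → ℕ) t (ts : Vec A n) q →
             encode bit (t ∷ ts) + 2 ^ suc n * q ≡ bit t + 2 * (encode bit ts + 2 ^ n * q)
encode-∷-+ {n = n} bit t ts q = regroup (bit t) (encode bit ts) (2 ^ n) q
  where
  regroup : ∀ b e p q → (b + 2 * e) + (2 * p) * q ≡ b + 2 * (e + p * q)
  regroup = solve 4
    (λ b e p q → (b :+ con 2 :* e) :+ (con 2 :* p) :* q := b :+ con 2 :* (e :+ p :* q)) refl

encode-∷-+-%2 : ∀ {A : Set} {n} (bit : A → ℕ) t (ts : Vec A n) q → bit t ≤ 1 →
                (encode bit (t ∷ ts) + 2 ^ suc n * q) % 2 ≡ bit t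
encode-∷-+-%2 {n = n} bit t ts q bit≤1 = trans (cong (_% 2) (encode-∷-+ bit t ts q))
  ([b+2*q]%2≡b (encode bit ts + 2 ^ n * q) bit≤1)

encode-∷-+-/2 : ∀ {A : Set} {n} (bit : A → ℕ) t (ts : Vec A n) q → bit t ≤ 1 →
                (encode bit (t ∷ ts) + 2 ^ suc n * q) / 2 ≡ encode bit ts + 2 ^ n * q
encode-∷-+-/2 {n = n} bit t ts q bit≤1 = trans (cong (_/ 2) (encode-∷-+ bit t ts q))
  ([b+2*q]/2≡q (encode bit ts + 2 ^ n * q) bit≤1)

trit : ℕ → ℕ → Trit
trit (suc _) _       = A
trit zero    (suc _) = B
trit zero    zero    = N

trit-bits : ∀ t → trit (bitA t) (bitB t) ≡ t
trit-bits N = refl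
trit-bits A = refl
trit-bits B = refl

bitA-trit : ∀ {a} b → a ≤ 1 → bitA (trit a b) ≡ a
bitA-trit {zero}  zero    _         = refl
bitA-trit {zero}  (suc b) _         = refl
bitA-trit {suc _} b       (s≤s z≤n) = refl

bitB-trit : ∀ {a b} → b ≤ 1 → a ≡ 0 ⊎ b ≡ 0 → bitB (trit a b) ≡ b
bitB-trit {zero}  {zero}  _         _         = refl
bitB-trit {zero}  {suc _} (s≤s z≤n) _         = refl
bitB-trit {suc _} {zero}  _         _         = refl
bitB-trit {suc _} {suc _} _         (inj₁ ())
bitB-trit {suc _} {suc _} _         (inj₂ ())

decode : (n : ℕ) → ℕ → ℕ → Vec Trit n
decode zero    x y = []
decode (suc n) x y = trit (x % 2) (y % 2) ∷ decode n (x / 2) (y / 2)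

shiftR : ℕ → ℕ → ℕ
shiftR zero    x = x
shiftR (suc n) x = shiftR n (x / 2)

encode-bitA-decode : ∀ n x y → encode bitA (decode n x y) + 2 ^ n * shiftR n x ≡ x
encode-bitA-decode zero    x y = +-identityʳ x
encode-bitA-decode (suc n) x y = begin
  encode bitA (t ∷ ts) + 2 ^ suc n * q ≡⟨ encode-∷-+ bitA t ts q ⟩
  bitA t + 2 * (encode bitA ts + 2 ^ n * q)
    ≡⟨ cong₂ (λ r q → r + 2 * q) (bitA-trit (y % 2) (m%2≤1 x)) (encode-bitA-decode n (x / 2) (y / 2)) ⟩
  x % 2 + 2 * (x / 2)                  ≡⟨ m≡m%2+2*[m/2] x ⟨
  x                                    ∎
  where
  open ≡-Reasoning
  t = trit (x % 2) (y % 2)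
  ts = decode n (x / 2) (y / 2)
  q = shiftR n (x / 2)

encode-bitB-decode : ∀ n x y → Disjoint n x y →
                     encode bitB (decode n x y) + 2 ^ n * shiftR n y ≡ y
encode-bitB-decode zero    x y _            = +-identityʳ y
encode-bitB-decode (suc n) x y (low , high) = begin
  encode bitB (t ∷ ts) + 2 ^ suc n * q ≡⟨ encode-∷-+ bitB t ts q ⟩
  bitB t + 2 * (encode bitB ts + 2 ^ n * q)
    ≡⟨ cong₂ (λ r q → r + 2 * q) (bitB-trit (m%2≤1 y) low) (encode-bitB-decode n (x / 2) (y / 2) high) ⟩
  y % 2 + 2 * (y / 2)                  ≡⟨ m≡m%2+2*[m/2] y ⟨
  y                                    ∎
  where
  open ≡-Reasoning
  t = trit (x % 2) (y % 2)
  ts = decode n (x / 2) (y / 2)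
  q = shiftR n (y / 2)

decode-encode : ∀ n (ts : Vec Trit n) q →
                decode n (encode bitA ts) (encode bitB ts + 2 ^ n * q) ≡ ts
decode-encode zero    []       q = refl
decode-encode (suc n) (t ∷ ts) q = cong₂ _∷_
  (trans (cong₂ trit ([b+2*q]%2≡b (encode bitA ts) (bitA≤1 t)) (encode-∷-+-%2 bitB t ts q (bitB≤1 t)))
         (trit-bits t))
  (trans (cong₂ (decode n) ([b+2*q]/2≡q (encode bitA ts) (bitA≤1 t)) (encode-∷-+-/2 bitB t ts q (bitB≤1 t)))
         (decode-encode n ts q))

Disjoint-encode : ∀ m {n} (ts : Vec Trit n) q →
                  Disjoint m (encode bitA ts) (encode bitB ts + 2 ^ n * q)
Disjoint-encode zero    ts       q = tt
Disjoint-encode (suc m) []       q = Disjoint-zeroˡ (suc m) (0 + 1 * q)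
Disjoint-encode (suc m) (t ∷ ts) q =
  map (trans ([b+2*q]%2≡b (encode bitA ts) (bitA≤1 t)))
      (trans (encode-∷-+-%2 bitB t ts q (bitB≤1 t)))
      (bitA≡0⊎bitB≡0 t) ,
  subst₂ (Disjoint m) (sym ([b+2*q]/2≡q (encode bitA ts) (bitA≤1 t)))
                      (sym (encode-∷-+-/2 bitB t ts q (bitB≤1 t)))
         (Disjoint-encode m ts q)

Disjoint⇒shiftR%2≡0 : ∀ n {x y} → Disjoint (suc n) x y → shiftR n x % 2 ≡ 0 ⊎ shiftR n y % 2 ≡ 0
Disjoint⇒shiftR%2≡0 zero    (low , _)  = low
Disjoint⇒shiftR%2≡0 (suc n) (_ , high) = Disjoint⇒shiftR%2≡0 n high

encode-decode-disjoint : ∀ n {a b} → a < b → (∀ m → Disjoint m a b) → 0 < b → digits b ≡ suc n →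
                         encode bitA (decode n a b) ≡ a × encode bitB (decode n a b) + 2 ^ n * 1 ≡ b
encode-decode-disjoint n {a} {b} a<b disjoint 0<b digits-b =
  trans (sym (m+n*0≡m ra (2 ^ n))) (subst (λ q → ra + 2 ^ n * q ≡ a) qa≡0 split-a) ,
  subst (λ q → rb + 2 ^ n * q ≡ b) qb≡1 split-b
  where
  ra = encode bitA (decode n a b)
  rb = encode bitB (decode n a b)
  qa = shiftR n a
  qb = shiftR n b
  split-a : ra + 2 ^ n * qa ≡ a
  split-a = encode-bitA-decode n a b
  split-b : rb + 2 ^ n * qb ≡ b
  split-b = encode-bitB-decode n a b (disjoint n)
  b<2^[1+n] : b < 2 ^ suc n
  b<2^[1+n] = digits≡1+n⇒m<2^[1+n] n digits-b
  qb≡1 : qb ≡ 1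
  qb≡1 = r<p≤r+p*q<2*p⇒q≡1 (encode-< bitB bitB≤1 (decode n a b))
           (subst (2 ^ n ≤_) (sym split-b) (digits≡1+n⇒2^n≤m n 0<b digits-b))
           (subst (_< 2 ^ suc n) (sym split-b) b<2^[1+n])
  -- bit n is set in b, hence not in a
  qa≡0 : qa ≡ 0
  qa≡0 with Disjoint⇒shiftR%2≡0 n (disjoint (suc n))
  ... | inj₂ qb%2≡0 = contradiction (trans (cong (_% 2) (sym qb≡1)) qb%2≡0) (λ ())
  ... | inj₁ qa%2≡0 = m≤1⇒m%2≡0⇒m≡0
    (r+p*q<2*p⇒q≤1 ra (2 ^ n) (subst (_< 2 ^ suc n) (sym split-a) (<-trans a<b b<2^[1+n])))
    qa%2≡0

-- Trit words containing an A, split at their first A.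
data TritsWithA : ℕ → Set where
  A∷_     : ∀ {n} → Vec Trit n → TritsWithA (suc n)
  N∷_ B∷_ : ∀ {n} → TritsWithA n → TritsWithA (suc n)

toVec : ∀ {n} → TritsWithA n → Vec Trit n
toVec (A∷ ts) = A ∷ ts
toVec (N∷ w)  = N ∷ toVec w
toVec (B∷ w)  = B ∷ toVec w

fromVec : ∀ {n} (ts : Vec Trit n) → 0 < encode bitA ts → TritsWithA n
fromVec (A ∷ ts) _   = A∷ ts
fromVec (N ∷ ts) 0<a = N∷ fromVec ts (*-cancelˡ-< 2 0 (encode bitA ts) 0<a)
fromVec (B ∷ ts) 0<a = B∷ fromVec ts (*-cancelˡ-< 2 0 (encode bitA ts) 0<a)

0<encode-bitA : ∀ {n} (w : TritsWithA n) → 0 < encode bitA (toVec w)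
0<encode-bitA (A∷ ts) = s≤s z≤n
0<encode-bitA (N∷ w)  = *-monoʳ-< 2 (0<encode-bitA w)
0<encode-bitA (B∷ w)  = *-monoʳ-< 2 (0<encode-bitA w)

toVec-fromVec : ∀ {n} (ts : Vec Trit n) 0<a → toVec (fromVec ts 0<a) ≡ ts
toVec-fromVec (A ∷ ts) _ = refl
toVec-fromVec (N ∷ ts) _ = cong (N ∷_) (toVec-fromVec ts _)
toVec-fromVec (B ∷ ts) _ = cong (B ∷_) (toVec-fromVec ts _)

fromVec-toVec : ∀ {n} (w : TritsWithA n) 0<a → fromVec (toVec w) 0<a ≡ w
fromVec-toVec (A∷ ts) _ = refl
fromVec-toVec (N∷ w)  _ = cong N∷_ (fromVec-toVec w _)
fromVec-toVec (B∷ w)  _ = cong B∷_ (fromVec-toVec w _)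

fromVec-≡ : ∀ {n} {ts : Vec Trit n} {w} 0<a → ts ≡ toVec w → fromVec ts 0<a ≡ w
fromVec-≡ {w = w} 0<a refl = fromVec-toVec w 0<a

smaller larger : ∀ {k} → Position k → ℕ
smaller (a , _)     = a
larger  (_ , b , _) = b

Position-≡ : ∀ {k} {x y : Position k} → smaller x ≡ smaller y → larger x ≡ larger y → x ≡ y
Position-≡ {x = a , b , p₁ , p₂ , p₃ , p₄} {.a , .b , q₁ , q₂ , q₃ , q₄} refl refl
  rewrite <-irrelevant p₁ q₁ | <-irrelevant p₂ q₂ | ≡-irrelevant p₃ q₃ | ≡-irrelevant p₄ q₄ = refl

toPosition : ∀ n → TritsWithA n → Position (suc n)
toPosition n w = a , b , 0<a , a<b , Disjoint⇒⊕-⊕-+≡0 (Disjoint-encode (a + b) ts 1) ,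
                 pilesWithDigits≡2 a b (a + b) digits-a≢1+n digits-b digits-a+b
  where
  ts = toVec w
  a = encode bitA ts
  c = encode bitB ts
  b = c + 2 ^ n * 1
  0<a : 0 < a
  0<a = 0<encode-bitA w
  a<2^n : a < 2 ^ n
  a<2^n = encode-< bitA bitA≤1 ts
  a<b : a < b
  a<b = <-≤-trans a<2^n (≤-trans (≤-reflexive (sym (*-identityʳ (2 ^ n)))) (m≤n+m _ c))
  digits-a≢1+n : digits a ≢ suc n
  digits-a≢1+n digits-a = <⇒≱ a<2^n (digits≡1+n⇒2^n≤m n 0<a digits-a)
  digits-b : digits b ≡ suc n
  digits-b = m<2^n⇒digits[m+2^n]≡1+n n (encode-< bitB bitB≤1 ts)
  digits-a+b : digits (a + b) ≡ suc n
  digits-a+b = subst (λ m → digits m ≡ suc n) (+-assoc a c (2 ^ n * 1))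
    (m<2^n⇒digits[m+2^n]≡1+n n
      (subst (_< 2 ^ n) (encode-+ bitA bitB ts) (encode-< _ bitA+bitB≤1 ts)))

decode-Position : ∀ n (x : Position (suc n)) →
                  encode bitA (decode n (smaller x) (larger x)) ≡ smaller x ×
                  encode bitB (decode n (smaller x) (larger x)) + 2 ^ n * 1 ≡ larger x
decode-Position n (a , b , 0<a , a<b , xor≡0 , two-piles) =
  encode-decode-disjoint n a<b (⊕-⊕-+≡0⇒Disjoint xor≡0) (<-trans 0<a a<b) digits-b
  where
  digits-b : digits b ≡ suc n
  digits-b = pilesWithDigits≡2⇒middle a b (a + b)
               (digits-mono-≤ (<⇒≤ a<b)) (digits-mono-≤ (m≤n+m b a)) two-piles

fromPosition : ∀ n → Position (suc n) → TritsWithA n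
fromPosition n x@(a , b , 0<a , _) =
  fromVec (decode n a b) (subst (0 <_) (sym (proj₁ (decode-Position n x))) 0<a)

toPosition-fromPosition : ∀ n x → toPosition n (fromPosition n x) ≡ x
toPosition-fromPosition n x@(a , b , _) = Position-≡
  (trans (cong (encode bitA) decoded) (proj₁ (decode-Position n x)))
  (trans (cong (λ ts → encode bitB ts + 2 ^ n * 1) decoded) (proj₂ (decode-Position n x)))
  where
  decoded : toVec (fromPosition n x) ≡ decode n a b
  decoded = toVec-fromVec (decode n a b) _

fromPosition-toPosition : ∀ n w → fromPosition n (toPosition n w) ≡ w
fromPosition-toPosition n w = fromVec-≡ _ (decode-encode n (toVec w) 1)

TritsWithA↔Position : ∀ n → TritsWithA n ↔ Position (suc n)
TritsWithA↔Position n =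
  mk↔ₛ′ (toPosition n) (fromPosition n) (toPosition-fromPosition n) (fromPosition-toPosition n)

-- Counting

Fin3↔Trit : Fin 3 ↔ Trit
Fin3↔Trit = mk↔ₛ′ to from to-from from-to
  where
  to : Fin 3 → Trit
  to 0F = N
  to 1F = A
  to 2F = B
  from : Trit → Fin 3
  from N = 0F
  from A = 1F
  from B = 2F
  to-from : ∀ t → to (from t) ≡ t
  to-from N = refl
  to-from A = refl
  to-from B = refl
  from-to : ∀ i → from (to i) ≡ i
  from-to 0F = refl
  from-to 1F = refl
  from-to 2F = refl

×↔Vec : ∀ {A : Set} n → (A × Vec A n) ↔ Vec A (suc n)
×↔Vec n = mk↔ₛ′ (λ (x , xs) → x ∷ xs) (λ { (x ∷ xs) → x , xs })
                (λ { (x ∷ xs) → refl }) (λ { (x , xs) → refl })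

Fin[3^n]↔Vec : ∀ n → Fin (3 ^ n) ↔ Vec Trit n
Fin[3^n]↔Vec zero    = mk↔ₛ′ (λ _ → []) (λ _ → 0F) (λ { [] → refl }) (λ { 0F → refl ; (Fin.suc ()) })
Fin[3^n]↔Vec (suc n) = begin
  Fin (3 * 3 ^ n)       ↔⟨ *↔× ⟩
  (Fin 3 × Fin (3 ^ n)) ↔⟨ Fin3↔Trit ×-↔ Fin[3^n]↔Vec n ⟩
  (Trit × Vec Trit n)   ↔⟨ ×↔Vec n ⟩
  Vec Trit (suc n)      ∎
  where open EquationalReasoning

TritsWithA-split : ∀ n → (Vec Trit n ⊎ (TritsWithA n ⊎ TritsWithA n)) ↔ TritsWithA (suc n)
TritsWithA-split n = mk↔ₛ′ to from to-from from-to
  where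
  to : Vec Trit n ⊎ (TritsWithA n ⊎ TritsWithA n) → TritsWithA (suc n)
  to (inj₁ ts)       = A∷ ts
  to (inj₂ (inj₁ w)) = N∷ w
  to (inj₂ (inj₂ w)) = B∷ w
  from : TritsWithA (suc n) → Vec Trit n ⊎ (TritsWithA n ⊎ TritsWithA n)
  from (A∷ ts) = inj₁ ts
  from (N∷ w)  = inj₂ (inj₁ w)
  from (B∷ w)  = inj₂ (inj₂ w)
  to-from : ∀ w → to (from w) ≡ w
  to-from (A∷ _) = refl
  to-from (N∷ _) = refl
  to-from (B∷ _) = refl
  from-to : ∀ x → from (to x) ≡ x
  from-to (inj₁ _)        = refl
  from-to (inj₂ (inj₁ _)) = refl
  from-to (inj₂ (inj₂ _)) = refl

3^[1+n]∸2^[1+n]≡3^n+[d+d] : ∀ n →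
  3 ^ suc n ∸ 2 ^ suc n ≡ 3 ^ n + ((3 ^ n ∸ 2 ^ n) + (3 ^ n ∸ 2 ^ n))
3^[1+n]∸2^[1+n]≡3^n+[d+d] n = begin
  (3 ^ n + 2 * 3 ^ n) ∸ 2 * 2 ^ n ≡⟨ +-∸-assoc (3 ^ n) (*-monoʳ-≤ 2 (^-monoˡ-≤ n (s≤s (s≤s z≤n)))) ⟩
  3 ^ n + (2 * 3 ^ n ∸ 2 * 2 ^ n) ≡⟨ cong (3 ^ n +_) (*-distribˡ-∸ 2 (3 ^ n) (2 ^ n)) ⟨
  3 ^ n + 2 * d                   ≡⟨ cong (λ e → 3 ^ n + (d + e)) (+-identityʳ d) ⟩
  3 ^ n + (d + d)                 ∎
  where
  open ≡-Reasoning
  d = 3 ^ n ∸ 2 ^ n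

Fin[3^n∸2^n]↔TritsWithA : ∀ n → Fin (3 ^ n ∸ 2 ^ n) ↔ TritsWithA n
Fin[3^n∸2^n]↔TritsWithA zero    = mk↔ₛ′ (λ ()) (λ ()) (λ ()) (λ ())
Fin[3^n∸2^n]↔TritsWithA (suc n) = begin
  Fin (3 ^ suc n ∸ 2 ^ suc n)                  ≡⟨ cong Fin (3^[1+n]∸2^[1+n]≡3^n+[d+d] n) ⟩
  Fin (3 ^ n + (d + d))                        ↔⟨ +↔⊎ ⟩
  (Fin (3 ^ n) ⊎ Fin (d + d))                  ↔⟨ Fin[3^n]↔Vec n ⊎-↔ +↔⊎ ⟩
  (Vec Trit n ⊎ (Fin d ⊎ Fin d))               ↔⟨ ↔-refl ⊎-↔ (IH ⊎-↔ IH) ⟩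
  (Vec Trit n ⊎ (TritsWithA n ⊎ TritsWithA n)) ↔⟨ TritsWithA-split n ⟩
  TritsWithA (suc n)                           ∎
  where
  open EquationalReasoning
  d = 3 ^ n ∸ 2 ^ n
  IH = Fin[3^n∸2^n]↔TritsWithA n

theorem7p7 : (k : ℕ) → 1 ≤ k → Fin (3 ^ (k ∸ 1) ∸ 2 ^ (k ∸ 1)) ↔ Position k
theorem7p7 (suc n) _ = ↔-trans (Fin[3^n∸2^n]↔TritsWithA n) (TritsWithA↔Position n)
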